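{- Fix $a,b,k\in\mathbb{N}$ with $\gcd(a,b)=1$. Define $a_1=a$, $a_2=b$, and $a_n=ka_{n-1}+a_{n-2}$ for $n\ge3$. Let $(x_n)_{n\ge1}$ be the sequence $1,1,1,2,2,2,1,1,1,2,2,2,\ldots$ and $(y_n)_{n\ge1}$ the sequence $2,2,2,1,1,1,2,2,2,1,1,1,\ldots$ (blocks of three alternating). (1) If $k$ is even, then $(\Gamma(a_n,a_{n+1}))_{n\ge1}$ is constant. (2) If $k$ is odd: (a) if $a,b$ are both odd, then $(\Gamma(a_n,a_{n+1}))_{n\ge3}$ equals $(x_n)_{n\ge1}$ or $(y_n)_{n\ge1}$; (b) if $a$ is odd and $b$ is even, then $(\Gamma(a_n,a_{n+1}))_{n\ge2}$ equals $(x_n)_{n\ge1}$ or $(y_n)_{n\ge1}$; (c) if $a$ is even and $b$ is odd, then $(\Gamma(a_n,a_{n+1}))_{n\ge1}$ equals $(x_n)_{n\ge1}$ or $(y_n)_{n\ge1}$.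
   Context: $\mathbb{N}$ denotes the positive integers. For coprime $a,b\in\mathbb{N}$, consider the equations (E1) $ax+by=\frac{(a-1)(b-1)}{2}$ and (E2) $ax+by+1=\frac{(a-1)(b-1)}{2}$. We say the pair $(a,b)$ uses (E1) if (E1) has a solution in nonnegative integers $x,y$. For arbitrary $a,b\in\mathbb{N}$ with $d=\gcd(a,b)$, define $\Gamma(a,b)=1$ if the coprime pair $(a/d,b/d)$ uses (E1), and $\Gamma(a,b)=2$ otherwise. -}

module Defs where

open import Data.Nat using (ℕ; zero; suc; _+_; _*_; _∸_; _<_; _≤_; _<ᵇ_)
open import Data.Bool using (true; false)
open import Data.Nat.DivMod using (_/_; _%_)
open import Data.Nat.GCD using (gcd)
open import Data.Product using (∃₂; _×_)
open import Data.Sum using (_⊎_)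
open import Relation.Nullary using (¬_)
open import Relation.Binary.PropositionalEquality using (_≡_)

-- division with junk value 0 for divisor 0 (never used: gcd of positive numbers is positive)
_div_ : ℕ → ℕ → ℕ
m div zero = 0
m div (suc d) = m / suc d

UsesE1 : ℕ → ℕ → Set
UsesE1 a b = ∃₂ λ x y → a * x + b * y ≡ ((a ∸ 1) * (b ∸ 1)) / 2

-- Γ(a,b) as a (functional) relation:  GammaIs a b v  means  Γ(a,b) = v
GammaIs : ℕ → ℕ → ℕ → Set
GammaIs a b v =
  (v ≡ 1 × UsesE1 (a div gcd a b) (b div gcd a b))
  ⊎ (v ≡ 2 × ¬ UsesE1 (a div gcd a b) (b div gcd a b))

-- the sequence a_n, 1-indexed (index 0 is an unused junk value)
aSeq : ℕ → ℕ → ℕ → ℕ → ℕ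
aSeq a b k zero = 0
aSeq a b k (suc zero) = a
aSeq a b k (suc (suc zero)) = b
aSeq a b k (suc (suc (suc n))) = k * aSeq a b k (suc (suc n)) + aSeq a b k (suc n)

xSeq : ℕ → ℕ
xSeq n with ((n ∸ 1) % 6) <ᵇ 3
... | true = 1
... | false = 2

ySeq : ℕ → ℕ
ySeq n = 3 ∸ xSeq n

{-# OPTIONS --safe #-}
module Submission where

-- Write N(q, p) = (q − 1)(p − 1)/2 for the right-hand side of (E1). Replacing a coprime pair
-- (q, p) by (q, p + q) keeps Γ when q is odd and flips it when q is even. For q = 2m + 1 the
-- representations of N(q, p) = m(p − 1) and of N(q, p + q) = m(p + q − 1) correspond by moving
-- q·y from one generator to the other. For even q, Sylvester's duality (of n and qp − q − p − n
-- at least one is representable) and the uniqueness of residues modulo q show that exactly one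
-- of N(q, p) and N(q, p + q) is representable. As Γ is symmetric, Γ(a_{n+1}, a_{n+2}) =
-- Γ(a_{n+1}, a_n + k·a_{n+1}) therefore equals Γ(a_n, a_{n+1}) when a_{n+1} is odd and is flipped
-- k times when a_{n+1} is even. For even k nothing ever changes; for odd k the parities of the
-- a_n repeat with period three (even, odd, odd), so Γ flips once every three steps.

open import Defs
open import Data.Nat using (ℕ; zero; suc; _+_; _*_; _∸_; _≤_; _<_; z≤n; s≤s; z<s; _≟_; anyUpTo?; >-nonZero)
open import Data.Nat.Properties
open import Data.Nat.DivMod using (_/_; _%_; m≡m%n+[m/n]*n; m%n<n; m*n/n≡m; n/1≡n; m/n≡1+[m∸n]/n; [m+n]%n≡m%n)
open import Data.Nat.Divisibility
  using (_∣_; _∣?_; divides; ∣n⇒∣m*n; ∣-refl; ∣⇒≤; ∣m+n∣m⇒∣n; ∣m∣n⇒∣m+n; m∣m*n)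
open import Data.Nat.Coprimality using (Coprime; coprime-divisor; coprime-Bézout; coprime-+; coprime⇒gcd≡1)
  renaming (sym to coprime-sym)
open import Data.Nat.GCD using (module Bézout)
open import Data.Nat.Primality using (euclidsLemma; prime?)
open import Data.Nat.Tactic.RingSolver using (solve)
open import Data.List using (_∷_; [])
open import Data.Product using (∃; ∃₂; _×_; _,_; proj₁; proj₂)
open import Data.Sum using (_⊎_; inj₁; inj₂; [_,_]′)
import Data.Sum as Sum
open import Data.Empty using (⊥; ⊥-elim)
open import Function.Base using (_∘_; id)
open import Function.Bundles using (_⇔_; mk⇔; module Equivalence)
open import Function.Properties.Equivalence using () renaming (trans to ⇔-trans; sym to ⇔-sym)
open import Relation.Binary using (tri<; tri≈; tri>)
open import Relation.Nullary using (¬_; Dec; yes; no; contradiction)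
open import Relation.Nullary.Decidable using (map′; from-yes)
open import Relation.Binary.PropositionalEquality
  using (_≡_; refl; sym; trans; cong; subst; subst₂; module ≡-Reasoning)

private variable
  P Q : Set
  a b i j n p q v x y z : ℕ

-- Numbers representable by two generators

Representable : ℕ → ℕ → ℕ → Set
Representable a b n = ∃₂ λ x y → a * x + b * y ≡ n

representable-swap : Representable a b n → Representable b a n
representable-swap {a} {b} (x , y , e) = y , x , trans (+-comm (b * y) (a * x)) e

representable? : 1 ≤ a → 1 ≤ b → ∀ n → Dec (Representable a b n)
representable? {a} {b} a≥1 b≥1 n =
  map′ (λ (x , _ , y , _ , e) → x , y , e) bounded
       (anyUpTo? (λ x → anyUpTo? (λ y → a * x + b * y ≟ n) (suc n)) (suc n))
  where
  bounded : Representable a b n → ∃ λ x → x < suc n × ∃ λ y → y < suc n × a * x + b * y ≡ n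
  bounded (x , y , e) =
    x , s≤s (≤-trans (m≤n*m x a {{>-nonZero a≥1}}) (≤-trans (m≤m+n (a * x) (b * y)) (≤-reflexive e))) ,
    y , s≤s (≤-trans (m≤n*m y b {{>-nonZero b≥1}}) (≤-trans (m≤n+m (b * y) (a * x)) (≤-reflexive e))) , e

coprime-+ʳ : Coprime q p → Coprime q (p + q)
coprime-+ʳ {q} {p} c = subst (Coprime q) (+-comm q p) (coprime-sym (coprime-+ (coprime-sym c)))

coprime-+-multiple : Coprime q p → ∀ j → Coprime q (p + j * q)
coprime-+-multiple {q} {p} c zero    = subst (Coprime q) (sym (+-identityʳ p)) c
coprime-+-multiple {q} {p} c (suc j) = subst (Coprime q) (+-assoc p q (j * q)) (coprime-+-multiple (coprime-+ʳ c) j)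

residue-<-absurd : Coprime q p → q * i + p * y ≡ q * j + p * z → y < z → z < q → ⊥
residue-<-absurd {q} {p} {i} {y} {j} c eq y<z z<q with m≤n⇒∃[o]m+o≡n y<z
... | d , refl = <-irrefl refl (≤-<-trans (≤-trans q≤1+d (s≤s (m≤n+m d y))) z<q)
  where
  qi≡qj+p[1+d] : q * i ≡ q * j + p * suc d
  qi≡qj+p[1+d] = +-cancelʳ-≡ (p * y) (q * i) (q * j + p * suc d) (begin
    q * i + p * y             ≡⟨ eq ⟩
    q * j + p * (suc y + d)   ≡⟨ solve (q ∷ j ∷ p ∷ y ∷ d ∷ []) ⟩
    q * j + p * suc d + p * y ∎)
    where open ≡-Reasoning
  q≤1+d : q ≤ suc d
  q≤1+d = ∣⇒≤ (coprime-divisor c (∣m+n∣m⇒∣n (subst (q ∣_) qi≡qj+p[1+d] (m∣m*n i)) (m∣m*n j)))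

coprime-residue-unique : Coprime q p → q * i + p * y ≡ q * j + p * z → y < q → z < q → y ≡ z
coprime-residue-unique {y = y} {z = z} c eq y<q z<q with <-cmp y z
... | tri< y<z _ _ = ⊥-elim (residue-<-absurd c eq y<z z<q)
... | tri≈ _ y≡z _ = y≡z
... | tri> _ _ z<y = ⊥-elim (residue-<-absurd c (sym eq) z<y y<q)


modular-inverse : Coprime (suc q) p → ∃ λ w → ∃₂ λ u v → 1 + suc q * u ≡ p * w + suc q * v
modular-inverse {q} {p} c with coprime-Bézout c
... | Bézout.-+ x y eq = y , x , 0 , (begin
  1 + suc q * x     ≡⟨ cong (1 +_) (*-comm (suc q) x) ⟩
  1 + x * suc q     ≡⟨ eq ⟩
  y * p             ≡⟨ solve (y ∷ p ∷ q ∷ []) ⟩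
  p * y + suc q * 0 ∎)
  where open ≡-Reasoning
... | Bézout.+- x y eq = y * q , x * q , 1 , (begin
  1 + suc q * (x * q)     ≡⟨ cong (1 +_) (*-assoc (suc q) x q) ⟨
  1 + suc q * x * q       ≡⟨ cong (λ m → 1 + m * q) (trans (*-comm (suc q) x) (sym eq)) ⟩
  1 + (1 + y * p) * q     ≡⟨ solve (y ∷ p ∷ q ∷ []) ⟩
  p * (y * q) + suc q * 1 ∎)
  where open ≡-Reasoning

-- n ≡ p·y (mod q) with y < q, stated without subtraction.
congruent-multiple : Coprime (suc q) p → ∀ n →
                     ∃ λ y → y < suc q × ∃₂ λ u v → n + suc q * u ≡ p * y + suc q * v
congruent-multiple {q} {p} c n with modular-inverse c
... | w , u , v , e with (n * w) % suc q | (n * w) / suc q | m≡m%n+[m/n]*n (n * w) (suc q) | m%n<n (n * w) (suc q)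
...   | r | d | nw≡r+dq | r<q = r , r<q , n * u , p * d + n * v , (begin
  n + suc q * (n * u)                   ≡⟨ solve (n ∷ q ∷ u ∷ []) ⟩
  n * (1 + suc q * u)                   ≡⟨ cong (n *_) e ⟩
  n * (p * w + suc q * v)               ≡⟨ solve (n ∷ p ∷ w ∷ q ∷ v ∷ []) ⟩
  p * (n * w) + suc q * (n * v)         ≡⟨ cong (λ m → p * m + suc q * (n * v)) nw≡r+dq ⟩
  p * (r + d * suc q) + suc q * (n * v) ≡⟨ solve (p ∷ r ∷ d ∷ q ∷ n ∷ v ∷ []) ⟩
  p * r + suc q * (p * d + n * v)       ∎)
  where open ≡-Reasoning

congruence-cases : ∀ {u v} → n + q * u ≡ p * y + q * v →
                   (∃ λ x → n ≡ q * x + p * y) ⊎ (∃ λ x → n + q * suc x ≡ p * y)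
congruence-cases {n} {q} {p} {y} {u} {v} e with ≤-<-connex u v
... | inj₁ u≤v with m≤n⇒∃[o]m+o≡n u≤v
...   | w , refl = inj₁ (w , +-cancelʳ-≡ (q * u) n (q * w + p * y) (begin
  n + q * u             ≡⟨ e ⟩
  p * y + q * (u + w)   ≡⟨ solve (p ∷ y ∷ q ∷ u ∷ w ∷ []) ⟩
  q * w + p * y + q * u ∎))
  where open ≡-Reasoning
congruence-cases {n} {q} {p} {y} {u} {v} e | inj₂ v<u with m≤n⇒∃[o]m+o≡n v<u
...   | w , refl = inj₂ (w , +-cancelʳ-≡ (q * v) (n + q * suc w) (p * y) (begin
  n + q * suc w + q * v ≡⟨ solve (n ∷ q ∷ w ∷ v ∷ []) ⟩
  n + q * (suc v + w)   ≡⟨ e ⟩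
  p * y + q * v         ∎))
  where open ≡-Reasoning

complement-representable : ∀ {n n′ d} → n + n′ + suc (y + d) + p ≡ suc (y + d) * p →
                           n + suc (y + d) * suc x ≡ p * y → suc (y + d) * x + p * d ≡ n′
complement-representable {y} {p} {x} {n} {n′} {d} total e =
  +-cancelʳ-≡ (n + suc (y + d) + p) (suc (y + d) * x + p * d) n′ (begin
    suc (y + d) * x + p * d + (n + suc (y + d) + p) ≡⟨ solve (y ∷ d ∷ x ∷ p ∷ n ∷ []) ⟩
    n + suc (y + d) * suc x + p * suc d            ≡⟨ cong (_+ p * suc d) e ⟩
    p * y + p * suc d                              ≡⟨ solve (p ∷ y ∷ d ∷ []) ⟩
    suc (y + d) * p                                ≡⟨ total ⟨
    n + n′ + suc (y + d) + p                       ≡⟨ solve (n ∷ n′ ∷ y ∷ d ∷ p ∷ []) ⟩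
    n′ + (n + suc (y + d) + p)                     ∎)
  where open ≡-Reasoning

-- Sylvester's duality: of n and n′ = qp − q − p − n, at least one is representable.
representable-or-dual : ∀ {n n′} → Coprime (suc q) p → n + n′ + suc q + p ≡ suc q * p →
                        Representable (suc q) p n ⊎ Representable (suc q) p n′
representable-or-dual {q} {p} {n} {n′} c total = from-congruence (congruent-multiple c n)
  where
  from-congruence : (∃ λ y → y < suc q × ∃₂ λ u v → n + suc q * u ≡ p * y + suc q * v) →
                    Representable (suc q) p n ⊎ Representable (suc q) p n′
  from-congruence (y , y<q , u , v , e) with congruence-cases {n = n} {q = suc q} {p = p} {y = y} e
  ... | inj₁ (x , n≡qx+py) = inj₁ (x , y , sym n≡qx+py)
  ... | inj₂ (x , e′) with m≤n⇒∃[o]m+o≡n y<q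
  ...   | d , refl = inj₂ (x , d , complement-representable total e′)

-- Adding one generator to the other

representable-shiftʳ : ∀ {m} → Representable q (suc p) (m * p) → Representable q (suc p + q) (m * (p + q))
representable-shiftʳ {q} {p} {m} (x , y , e) with m≤n⇒∃[o]m+o≡n y≤m
  where
  y≤m : y ≤ m
  y≤m = *-cancelˡ-≤ (suc p) (begin
    suc p * y         ≤⟨ m≤n+m (suc p * y) (q * x) ⟩
    q * x + suc p * y ≡⟨ e ⟩
    m * p             ≤⟨ m≤n+m (m * p) m ⟩
    m + m * p         ≡⟨ solve (m ∷ p ∷ []) ⟩
    suc p * m         ∎)
    where open ≤-Reasoning
... | t , refl = x + t , y , (begin
  q * (x + t) + (suc p + q) * y     ≡⟨ solve (q ∷ x ∷ t ∷ p ∷ y ∷ []) ⟩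
  (q * x + suc p * y) + q * (y + t) ≡⟨ cong (_+ q * (y + t)) e ⟩
  (y + t) * p + q * (y + t)         ≡⟨ solve (y ∷ t ∷ p ∷ q ∷ []) ⟩
  (y + t) * (p + q)                 ∎)
  where open ≡-Reasoning

representable-shiftˡ : ∀ {m} → m ≤ q → Representable q (suc p + q) (m * (p + q)) → Representable q (suc p) (m * p)
representable-shiftˡ {q} {p} {m} m≤q (x , y , e) with ≤-<-connex m (x + y)
... | inj₂ x+y<m = ⊥-elim (<-irrefl refl (<-≤-trans x+y<m (≤-trans m≤q (≤-trans (m≤n+m q p) p+q≤x+y))))
  where
  open ≤-Reasoning
  p+q≤x+y : p + q ≤ x + y
  p+q≤x+y = +-cancelʳ-≤ ((x + y) * (p + q)) (p + q) (x + y) (begin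
    suc (x + y) * (p + q)         ≤⟨ *-monoˡ-≤ (p + q) x+y<m ⟩
    m * (p + q)                   ≡⟨ e ⟨
    q * x + (suc p + q) * y       ≡⟨ solve (q ∷ x ∷ p ∷ y ∷ []) ⟩
    q * (x + y) + suc p * y       ≤⟨ +-monoʳ-≤ (q * (x + y)) (*-monoʳ-≤ (suc p) (m≤n+m y x)) ⟩
    q * (x + y) + suc p * (x + y) ≡⟨ solve (q ∷ x ∷ y ∷ p ∷ []) ⟩
    (x + y) + (x + y) * (p + q)   ∎)
... | inj₁ m≤x+y with m≤n⇒∃[o]m+o≡n m≤x+y
...   | t , m+t≡x+y = t , y , +-cancelʳ-≡ (q * m) _ _ (begin
  q * t + suc p * y + q * m         ≡⟨ solve (q ∷ t ∷ p ∷ y ∷ m ∷ []) ⟩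
  q * (m + t) + suc p * y           ≡⟨ cong (λ s → q * s + suc p * y) m+t≡x+y ⟩
  q * (x + y) + suc p * y           ≡⟨ solve (q ∷ x ∷ y ∷ p ∷ []) ⟩
  q * x + (suc p + q) * y           ≡⟨ e ⟩
  m * (p + q)                       ≡⟨ solve (m ∷ p ∷ q ∷ []) ⟩
  m * p + q * m                     ∎)
  where open ≡-Reasoning

-- Both directions move q·y between the two generators; m ≤ q is needed only from right to left.
representable-shift : ∀ {m} → m ≤ q → Representable q (suc p) (m * p) ⇔ Representable q (suc p + q) (m * (p + q))
representable-shift {q = q} {p = p} {m} m≤q =
  mk⇔ (representable-shiftʳ {q = q} {p = p} {m}) (representable-shiftˡ {q = q} {p = p} {m} m≤q)

-- For q = 2(m + 1) and p = 2t + 1 the genera are N = (2m + 1)t and N′ = N + (2m + 1)(m + 1).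
-- By size, the p-coefficients y and y′ of the two representations are below m + 1; regrouping
-- turns them into representations of one number with distinct residues y and y′ + m + 1 below q.
even-shift-exclusive : ∀ {m t n} → Coprime (suc m * 2) (suc (t * 2)) → n ≤ suc (m * 2) * t →
                       Representable (suc m * 2) (suc (t * 2)) n →
                       ¬ Representable (suc m * 2) (suc (t * 2) + suc m * 2) (n + suc (m * 2) * suc m)
even-shift-exclusive {m} {t} {n} c n≤ (x , y , e) (x′ , y′ , e′) =
  <-irrefl (coprime-residue-unique {i = x + t + suc m} {j = x′ + y′} c same-value y<q y′+M<q)
           (<-≤-trans y<M (m≤n+m (suc m) y′))
  where
  open ≤-Reasoning
  y<M : y < suc m
  y<M = *-cancelˡ-< (suc (t * 2)) y (suc m) (begin-strict
    suc (t * 2) * y                         ≤⟨ m≤n+m _ (suc m * 2 * x) ⟩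
    suc m * 2 * x + suc (t * 2) * y         ≡⟨ e ⟩
    n                                       ≤⟨ n≤ ⟩
    suc (m * 2) * t                         <⟨ m<m+n _ z<s ⟩
    suc (m * 2) * t + suc (m + t)           ≡⟨ solve (m ∷ t ∷ []) ⟩
    suc (t * 2) * suc m                     ∎)
  y′<M : y′ < suc m
  y′<M = *-cancelˡ-< (suc (t * 2) + suc m * 2) y′ (suc m) (begin-strict
    (suc (t * 2) + suc m * 2) * y′                         ≤⟨ m≤n+m _ (suc m * 2 * x′) ⟩
    suc m * 2 * x′ + (suc (t * 2) + suc m * 2) * y′        ≡⟨ e′ ⟩
    n + suc (m * 2) * suc m                                ≤⟨ +-monoˡ-≤ _ n≤ ⟩
    suc (m * 2) * t + suc (m * 2) * suc m                  <⟨ m<m+n _ z<s ⟩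
    suc (m * 2) * t + suc (m * 2) * suc m + (2 + m * 2 + t) ≡⟨ solve (m ∷ t ∷ []) ⟩
    (suc (t * 2) + suc m * 2) * suc m                      ∎)
  y<q : y < suc m * 2
  y<q = <-≤-trans y<M (m≤m*n (suc m) 2)
  y′+M<q : y′ + suc m < suc m * 2
  y′+M<q = begin-strict
    y′ + suc m    <⟨ +-monoˡ-< (suc m) y′<M ⟩
    suc m + suc m ≡⟨ solve (m ∷ []) ⟩
    suc m * 2     ∎
  same-value : suc m * 2 * (x + t + suc m) + suc (t * 2) * y ≡ suc m * 2 * (x′ + y′) + suc (t * 2) * (y′ + suc m)
  same-value = begin-equality
    suc m * 2 * (x + t + suc m) + suc (t * 2) * y
      ≡⟨ solve (m ∷ x ∷ t ∷ y ∷ []) ⟩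
    (suc m * 2 * x + suc (t * 2) * y) + suc (m * 2) * suc m + suc (t * 2) * suc m
      ≡⟨ cong (λ k → k + suc (m * 2) * suc m + suc (t * 2) * suc m) e ⟩
    n + suc (m * 2) * suc m + suc (t * 2) * suc m
      ≡⟨ cong (_+ suc (t * 2) * suc m) e′ ⟨
    suc m * 2 * x′ + (suc (t * 2) + suc m * 2) * y′ + suc (t * 2) * suc m
      ≡⟨ solve (m ∷ x′ ∷ t ∷ y′ ∷ []) ⟩
    suc m * 2 * (x′ + y′) + suc (t * 2) * (y′ + suc m) ∎

-- By duality N − 1 is representable over (q, p); if N′ were not representable over (q, p + q),
-- then N′ − 1 = (N − 1) + (2m + 1)(m + 1) would be, against even-shift-exclusive.
even-shift-exhaustive : ∀ {m t} → Coprime (suc m * 2) (suc (t * 2)) →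
                        ¬ Representable (suc m * 2) (suc (t * 2)) (suc (m * 2) * t) →
                        Representable (suc m * 2) (suc (t * 2) + suc m * 2) (suc (m * 2) * t + suc (m * 2) * suc m)
even-shift-exhaustive {m} {zero} c ¬r = ⊥-elim (¬r (0 , 0 , solve (m ∷ [])))
even-shift-exhaustive {m} {suc t} c ¬r = [ (⊥-elim ∘ ¬r) , from-predecessor ]′ (representable-or-dual c total)
  where
  total : suc (m * 2) * suc t + (suc (m * 2) * t + m * 2) + suc m * 2 + suc (suc t * 2) ≡ suc m * 2 * suc (suc t * 2)
  total = solve (m ∷ t ∷ [])
  total′ : suc (m * 2) * suc t + suc (m * 2) * suc m + (suc (m * 2) * t + m * 2 + suc (m * 2) * suc m)
           + suc m * 2 + (suc (suc t * 2) + suc m * 2) ≡ suc m * 2 * (suc (suc t * 2) + suc m * 2)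
  total′ = solve (m ∷ t ∷ [])
  below : suc (m * 2) * t + m * 2 ≤ suc (m * 2) * suc t
  below = begin
    suc (m * 2) * t + m * 2     ≤⟨ m≤m+n _ 1 ⟩
    suc (m * 2) * t + m * 2 + 1 ≡⟨ solve (m ∷ t ∷ []) ⟩
    suc (m * 2) * suc t         ∎
    where open ≤-Reasoning
  from-predecessor : Representable (suc m * 2) (suc (suc t * 2)) (suc (m * 2) * t + m * 2) →
                     Representable (suc m * 2) (suc (suc t * 2) + suc m * 2) (suc (m * 2) * suc t + suc (m * 2) * suc m)
  from-predecessor r = [ id , (⊥-elim ∘ even-shift-exclusive {m} {suc t} c below r) ]′
                         (representable-or-dual (coprime-+ʳ c) total′)

-- Γ of coprime pairs

genus : ℕ → ℕ → ℕ
genus a b = ((a ∸ 1) * (b ∸ 1)) / 2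

m*[n*2]/2≡m*n : ∀ m n → m * (n * 2) / 2 ≡ m * n
m*[n*2]/2≡m*n m n = trans (cong (_/ 2) (sym (*-assoc m n 2))) (m*n/n≡m (m * n) 2)

genus-oddˡ : ∀ m b → genus (suc (m * 2)) b ≡ m * (b ∸ 1)
genus-oddˡ m b = begin
  m * 2 * (b ∸ 1) / 2   ≡⟨ cong (_/ 2) (*-assoc m 2 (b ∸ 1)) ⟩
  m * (2 * (b ∸ 1)) / 2 ≡⟨ cong (λ c → m * c / 2) (*-comm 2 (b ∸ 1)) ⟩
  m * ((b ∸ 1) * 2) / 2 ≡⟨ m*[n*2]/2≡m*n m (b ∸ 1) ⟩
  m * (b ∸ 1)           ∎
  where open ≡-Reasoning

genus-oddʳ : ∀ a t → genus a (suc (t * 2)) ≡ (a ∸ 1) * t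
genus-oddʳ a t = m*[n*2]/2≡m*n (a ∸ 1) t

genus-even-shift : ∀ m t → genus (suc m * 2) (suc (t * 2) + suc m * 2) ≡ suc (m * 2) * t + suc (m * 2) * suc m
genus-even-shift m t = begin
  genus (suc m * 2) (suc (t * 2 + suc m * 2))   ≡⟨ cong (λ r → genus (suc m * 2) (suc r)) (*-distribʳ-+ 2 t (suc m)) ⟨
  genus (suc m * 2) (suc ((t + suc m) * 2))     ≡⟨ genus-oddʳ (suc m * 2) (t + suc m) ⟩
  suc (m * 2) * (t + suc m)                     ≡⟨ *-distribˡ-+ (suc (m * 2)) t (suc m) ⟩
  suc (m * 2) * t + suc (m * 2) * suc m         ∎
  where open ≡-Reasoning

Indicator : Set → ℕ → Set
Indicator P v = (v ≡ 1 × P) ⊎ (v ≡ 2 × ¬ P)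

indicator-cong : P ⇔ Q → Indicator P v → Indicator Q v
indicator-cong P⇔Q (inj₁ (v≡1 , p)) = inj₁ (v≡1 , Equivalence.to P⇔Q p)
indicator-cong P⇔Q (inj₂ (v≡2 , ¬p)) = inj₂ (v≡2 , ¬p ∘ Equivalence.from P⇔Q)

indicator-flip : (P → ¬ Q) → (¬ P → Q) → Indicator P v → Indicator Q (3 ∸ v)
indicator-flip exclusive exhaustive (inj₁ (refl , p)) = inj₂ (refl , exclusive p)
indicator-flip exclusive exhaustive (inj₂ (refl , ¬p)) = inj₁ (refl , exhaustive ¬p)

indicator? : Dec P → Indicator P 1 ⊎ Indicator P 2
indicator? (yes p) = inj₁ (inj₁ (refl , p))
indicator? (no ¬p) = inj₂ (inj₂ (refl , ¬p))

indicator-≤ : Indicator P v → v ≤ 3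
indicator-≤ (inj₁ (refl , _)) = s≤s z≤n
indicator-≤ (inj₂ (refl , _)) = s≤s (s≤s z≤n)

odd-form : ¬ 2 ∣ n → ∃ λ m → n ≡ suc (m * 2)
odd-form {zero} ¬2∣n = ⊥-elim (¬2∣n (divides 0 refl))
odd-form {suc zero} _ = 0 , refl
odd-form {suc (suc n)} ¬2∣n with odd-form {n} (¬2∣n ∘ ∣m∣n⇒∣m+n (∣-refl {2}))
... | m , refl = suc m , refl

even-form : 2 ∣ n → 1 ≤ n → ∃ λ m → n ≡ suc m * 2
even-form (divides (suc m) refl) _ = m , refl

CoprimeΓ : ℕ → ℕ → ℕ → Set
CoprimeΓ a b = Indicator (UsesE1 a b)

coprimeΓ⇒GammaIs : Coprime a b → CoprimeΓ a b v → GammaIs a b v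
coprimeΓ⇒GammaIs {a} {b} c g rewrite coprime⇒gcd≡1 c | n/1≡n a | n/1≡n b = g

uses-E1⇔ : ∀ a b {g} → genus a b ≡ g → UsesE1 a b ⇔ Representable a b g
uses-E1⇔ a b refl = mk⇔ id id

uses-E1-swap : ∀ a b → UsesE1 a b → UsesE1 b a
uses-E1-swap a b = subst (Representable b a) (cong (_/ 2) (*-comm (a ∸ 1) (b ∸ 1))) ∘ representable-swap {a} {b}

Γ-swap : CoprimeΓ a b v → CoprimeΓ b a v
Γ-swap {a} {b} = indicator-cong (mk⇔ (uses-E1-swap a b) (uses-E1-swap b a))

Γ-add-odd : ¬ 2 ∣ q → 1 ≤ p → CoprimeΓ q p v → CoprimeΓ q (p + q) v
Γ-add-odd {q} {suc p} ¬2∣q _ with odd-form ¬2∣q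
... | m , refl = indicator-cong
  (⇔-trans (uses-E1⇔ (suc (m * 2)) (suc p) (genus-oddˡ m (suc p)))
  (⇔-trans (representable-shift {q = suc (m * 2)} {p = p} (≤-trans (m≤m*n m 2) (n≤1+n (m * 2))))
           (⇔-sym (uses-E1⇔ (suc (m * 2)) (suc p + suc (m * 2)) (genus-oddˡ m (suc p + suc (m * 2)))))))

Γ-add-even : 2 ∣ q → 1 ≤ q → Coprime q p → CoprimeΓ q p v → CoprimeΓ q (p + q) (3 ∸ v)
Γ-add-even {q} {p} 2∣q q≥1 c with even-form 2∣q q≥1 | odd-form {p} (λ 2∣p → contradiction (c (2∣q , 2∣p)) λ ())
... | m , refl | t , refl = indicator-flip
  (λ r r′ → even-shift-exclusive {m} {t} c ≤-refl (Equivalence.to at-genus r) (Equivalence.to at-shifted-genus r′))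
  (λ ¬r → Equivalence.from at-shifted-genus (even-shift-exhaustive {m} {t} c (¬r ∘ Equivalence.from at-genus)))
  where
  at-genus : UsesE1 (suc m * 2) (suc (t * 2)) ⇔ Representable (suc m * 2) (suc (t * 2)) (suc (m * 2) * t)
  at-genus = uses-E1⇔ (suc m * 2) (suc (t * 2)) (genus-oddʳ (suc m * 2) t)
  at-shifted-genus : UsesE1 (suc m * 2) (suc (t * 2) + suc m * 2)
                  ⇔ Representable (suc m * 2) (suc (t * 2) + suc m * 2) (suc (m * 2) * t + suc (m * 2) * suc m)
  at-shifted-genus = uses-E1⇔ (suc m * 2) (suc (t * 2) + suc m * 2) (genus-even-shift m t)

toggle : ℕ → ℕ → ℕ
toggle zero    v = v
toggle (suc j) v = toggle j (3 ∸ v)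

toggle-twice : ∀ i → v ≤ 3 → toggle (i * 2) v ≡ v
toggle-twice zero        _   = refl
toggle-twice {v} (suc i) v≤3 = trans (toggle-twice i (m∸n≤m 3 (3 ∸ v))) (m∸[m∸n]≡n v≤3)

toggle-even : ∀ {j} → 2 ∣ j → v ≤ 3 → toggle j v ≡ v
toggle-even (divides i refl) = toggle-twice i

toggle-odd : ∀ {j} → ¬ 2 ∣ j → toggle j v ≡ 3 ∸ v
toggle-odd {v} ¬2∣j with odd-form ¬2∣j
... | i , refl = toggle-twice i (m∸n≤m 3 v)

toggle-3∸ : ∀ j → toggle j (3 ∸ v) ≡ 3 ∸ toggle j v
toggle-3∸ zero    = refl
toggle-3∸ (suc j) = toggle-3∸ j

Γ-add-multiple-odd : ¬ 2 ∣ q → 1 ≤ p → CoprimeΓ q p v → ∀ j → CoprimeΓ q (p + j * q) v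
Γ-add-multiple-odd {q} {p} {v} _ _ g zero = subst (λ b → CoprimeΓ q b v) (sym (+-identityʳ p)) g
Γ-add-multiple-odd {q} {p} {v} ¬2∣q p≥1 g (suc j) =
  subst (λ b → CoprimeΓ q b v) (+-assoc p q (j * q))
    (Γ-add-multiple-odd ¬2∣q (≤-trans p≥1 (m≤m+n p q)) (Γ-add-odd ¬2∣q p≥1 g) j)

Γ-add-multiple-even : 2 ∣ q → 1 ≤ q → Coprime q p → CoprimeΓ q p v → ∀ j → CoprimeΓ q (p + j * q) (toggle j v)
Γ-add-multiple-even {q} {p} {v} _ _ _ g zero = subst (λ b → CoprimeΓ q b v) (sym (+-identityʳ p)) g
Γ-add-multiple-even {q} {p} {v} 2∣q q≥1 c g (suc j) =
  subst (λ b → CoprimeΓ q b (toggle (suc j) v)) (+-assoc p q (j * q))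
    (Γ-add-multiple-even 2∣q q≥1 (coprime-+ʳ c) (Γ-add-even 2∣q q≥1 c g) j)

Γ-step-odd : ∀ k → Coprime p q → 1 ≤ p → ¬ 2 ∣ q → CoprimeΓ p q v → CoprimeΓ q (k * q + p) v
Γ-step-odd {p} {q} {v} k _ p≥1 ¬2∣q g =
  subst (λ b → CoprimeΓ q b v) (+-comm p (k * q)) (Γ-add-multiple-odd ¬2∣q p≥1 (Γ-swap {p} {q} g) k)

Γ-step-even : ∀ k → Coprime p q → 1 ≤ q → 2 ∣ q → CoprimeΓ p q v → CoprimeΓ q (k * q + p) (toggle k v)
Γ-step-even {p} {q} {v} k c q≥1 2∣q g =
  subst (λ b → CoprimeΓ q b (toggle k v)) (+-comm p (k * q))
    (Γ-add-multiple-even 2∣q q≥1 (coprime-sym c) (Γ-swap {p} {q} g) k)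

even+odd : 2 ∣ a → ¬ 2 ∣ b → ¬ 2 ∣ (a + b)
even+odd 2∣a ¬2∣b 2∣a+b = ¬2∣b (∣m+n∣m⇒∣n 2∣a+b 2∣a)

odd+even : ¬ 2 ∣ a → 2 ∣ b → ¬ 2 ∣ (a + b)
odd+even {a} {b} ¬2∣a 2∣b = even+odd 2∣b ¬2∣a ∘ subst (2 ∣_) (+-comm a b)

odd+odd : ¬ 2 ∣ a → ¬ 2 ∣ b → 2 ∣ (a + b)
odd+odd ¬2∣a ¬2∣b with odd-form ¬2∣a | odd-form ¬2∣b
... | x , refl | y , refl = divides (suc (x + y)) (solve (x ∷ y ∷ []))

odd*odd : ¬ 2 ∣ a → ¬ 2 ∣ b → ¬ 2 ∣ (a * b)
odd*odd {a} {b} ¬2∣a ¬2∣b = [ ¬2∣a , ¬2∣b ]′ ∘ euclidsLemma a b (from-yes (prime? 2))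

-- Sequences with s (n + 2) = k · s (n + 1) + s n

Recurrence : ℕ → (ℕ → ℕ) → Set
Recurrence k s = ∀ n → s (2 + n) ≡ k * s (1 + n) + s n

record CoprimeRecurrence (k : ℕ) (s : ℕ → ℕ) : Set where
  field
    recurrence : Recurrence k s
    positive   : ∀ n → 1 ≤ s n
    coprime    : ∀ n → Coprime (s n) (s (1 + n))

coprime-recurrence : ∀ {k s} → Recurrence k s → 1 ≤ s 0 → 1 ≤ s 1 → Coprime (s 0) (s 1) → CoprimeRecurrence k s
coprime-recurrence {k} {s} rec s₀≥1 s₁≥1 c = record { recurrence = rec ; positive = positive ; coprime = coprime }
  where
  positive : ∀ n → 1 ≤ s n
  positive zero          = s₀≥1
  positive (suc zero)    = s₁≥1
  positive (suc (suc n)) = subst (1 ≤_) (sym (rec n)) (≤-trans (positive n) (m≤n+m (s n) (k * s (1 + n))))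
  coprime : ∀ n → Coprime (s n) (s (1 + n))
  coprime zero    = c
  coprime (suc n) = subst (Coprime (s (1 + n))) (trans (+-comm (s n) (k * s (1 + n))) (sym (rec n)))
                      (coprime-+-multiple (coprime-sym (coprime n)) k)

drop : ∀ {k s} → CoprimeRecurrence k s → CoprimeRecurrence k (s ∘ suc)
drop r = record { recurrence = recurrence ∘ suc ; positive = positive ∘ suc ; coprime = coprime ∘ suc }
  where open CoprimeRecurrence r

odd-recurrence-parity : ∀ {k s} → ¬ 2 ∣ k → Recurrence k s → 2 ∣ s 0 → ¬ 2 ∣ s 1 →
                        ¬ 2 ∣ s 2 × 2 ∣ s 3 × ¬ 2 ∣ s 4
odd-recurrence-parity {k} {s} ¬2∣k rec 2∣s₀ ¬2∣s₁ = ¬2∣s₂ , 2∣s₃ , ¬2∣s₄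
  where
  ¬2∣s₂ : ¬ 2 ∣ s 2
  ¬2∣s₂ = subst (λ m → ¬ 2 ∣ m) (sym (rec 0)) (odd+even (odd*odd ¬2∣k ¬2∣s₁) 2∣s₀)
  2∣s₃ : 2 ∣ s 3
  2∣s₃ = subst (2 ∣_) (sym (rec 1)) (odd+odd (odd*odd ¬2∣k ¬2∣s₂) ¬2∣s₁)
  ¬2∣s₄ : ¬ 2 ∣ s 4
  ¬2∣s₄ = subst (λ m → ¬ 2 ∣ m) (sym (rec 2)) (even+odd (∣n⇒∣m*n k 2∣s₃) ¬2∣s₂)

GammaAt : (ℕ → ℕ) → ℕ → ℕ → Set
GammaAt s n = CoprimeΓ (s n) (s (1 + n))

module _ {k : ℕ} {s : ℕ → ℕ} (r : CoprimeRecurrence k s) where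
  open CoprimeRecurrence r

  Γ-next-odd : ¬ 2 ∣ s (1 + n) → GammaAt s n v → GammaAt s (1 + n) v
  Γ-next-odd {n} {v} ¬2∣ g =
    subst (λ b → CoprimeΓ (s (1 + n)) b v) (sym (recurrence n)) (Γ-step-odd k (coprime n) (positive n) ¬2∣ g)

  Γ-next-even : 2 ∣ s (1 + n) → GammaAt s n v → GammaAt s (1 + n) (toggle k v)
  Γ-next-even {n} {v} 2∣ g =
    subst (λ b → CoprimeΓ (s (1 + n)) b (toggle k v)) (sym (recurrence n)) (Γ-step-even k (coprime n) (positive (1 + n)) 2∣ g)

  Γ-constant : 2 ∣ k → GammaAt s 0 v → ∀ n → GammaAt s n v
  Γ-constant _ g zero = g
  Γ-constant {v} 2∣k g (suc n) with 2 ∣? s (1 + n)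
  ... | no ¬2∣ = Γ-next-odd ¬2∣ (Γ-constant 2∣k g n)
  ... | yes 2∣ = subst (GammaAt s (1 + n)) (toggle-even 2∣k (indicator-≤ g)) (Γ-next-even 2∣ (Γ-constant 2∣k g n))

Γ-odd-block : ∀ {k s} → CoprimeRecurrence k s → ¬ 2 ∣ k → 2 ∣ s 0 → ¬ 2 ∣ s 1 → GammaAt s 0 v →
              GammaAt s 1 v × GammaAt s 2 v × GammaAt s 3 (3 ∸ v)
Γ-odd-block {v} {k} {s} r ¬2∣k 2∣s₀ ¬2∣s₁ g₀ = g₁ , g₂ , g₃
  where
  parity : ¬ 2 ∣ s 2 × 2 ∣ s 3 × ¬ 2 ∣ s 4
  parity = odd-recurrence-parity ¬2∣k (CoprimeRecurrence.recurrence r) 2∣s₀ ¬2∣s₁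
  g₁ : GammaAt s 1 v
  g₁ = Γ-next-odd r ¬2∣s₁ g₀
  g₂ : GammaAt s 2 v
  g₂ = Γ-next-odd r (proj₁ parity) g₁
  g₃ : GammaAt s 3 (3 ∸ v)
  g₃ = subst (GammaAt s 3) (toggle-odd ¬2∣k) (Γ-next-even r (proj₁ (proj₂ parity)) g₂)

[3+n]/3≡1+n/3 : ∀ n → (3 + n) / 3 ≡ suc (n / 3)
[3+n]/3≡1+n/3 n = m/n≡1+[m∸n]/n {3 + n} {3} (s≤s (s≤s (s≤s z≤n)))

Γ-odd-pattern : ∀ {k s} → CoprimeRecurrence k s → ¬ 2 ∣ k → 2 ∣ s 0 → ¬ 2 ∣ s 1 → GammaAt s 0 v →
                ∀ i → GammaAt s i (toggle (i / 3) v)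
Γ-odd-pattern r ¬2∣k 2∣s₀ ¬2∣s₁ g zero = g
Γ-odd-pattern r ¬2∣k 2∣s₀ ¬2∣s₁ g (suc zero) = proj₁ (Γ-odd-block r ¬2∣k 2∣s₀ ¬2∣s₁ g)
Γ-odd-pattern r ¬2∣k 2∣s₀ ¬2∣s₁ g (suc (suc zero)) = proj₁ (proj₂ (Γ-odd-block r ¬2∣k 2∣s₀ ¬2∣s₁ g))
Γ-odd-pattern {v} {k} {s} r ¬2∣k 2∣s₀ ¬2∣s₁ g (suc (suc (suc i))) =
  subst (λ j → GammaAt s (3 + i) (toggle j v)) (sym ([3+n]/3≡1+n/3 i))
    (Γ-odd-pattern (drop (drop (drop r))) ¬2∣k (proj₁ (proj₂ parity)) (proj₂ (proj₂ parity))
      (proj₂ (proj₂ (Γ-odd-block r ¬2∣k 2∣s₀ ¬2∣s₁ g))) i)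
  where parity = odd-recurrence-parity ¬2∣k (CoprimeRecurrence.recurrence r) 2∣s₀ ¬2∣s₁

xSeq-mod : ∀ i j → i % 6 ≡ j % 6 → xSeq (suc i) ≡ xSeq (suc j)
xSeq-mod i j i%6≡j%6 rewrite i%6≡j%6 = refl

xSeq-periodic : ∀ i → xSeq (suc (6 + i)) ≡ xSeq (suc i)
xSeq-periodic i = xSeq-mod (6 + i) i (trans (cong (_% 6) (+-comm 6 i)) ([m+n]%n≡m%n i 6))

xSeq-toggle : ∀ i → xSeq (suc i) ≡ toggle (i / 3) 1
xSeq-toggle 0 = refl
xSeq-toggle 1 = refl
xSeq-toggle 2 = refl
xSeq-toggle 3 = refl
xSeq-toggle 4 = refl
xSeq-toggle 5 = refl
xSeq-toggle (suc (suc (suc (suc (suc (suc i)))))) = begin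
  xSeq (suc (6 + i))          ≡⟨ xSeq-periodic i ⟩
  xSeq (suc i)                ≡⟨ xSeq-toggle i ⟩
  toggle (i / 3) 1            ≡⟨ cong (λ j → toggle j 1) (trans ([3+n]/3≡1+n/3 (3 + i)) (cong suc ([3+n]/3≡1+n/3 i))) ⟨
  toggle ((6 + i) / 3) 1      ∎
  where open ≡-Reasoning

ySeq-toggle : ∀ i → ySeq (suc i) ≡ toggle (i / 3) 2
ySeq-toggle i = trans (cong (3 ∸_) (xSeq-toggle i)) (sym (toggle-3∸ (i / 3)))

coprimeΓ? : 1 ≤ a → 1 ≤ b → CoprimeΓ a b 1 ⊎ CoprimeΓ a b 2
coprimeΓ? a≥1 b≥1 = indicator? (representable? a≥1 b≥1 _)

module _ {k : ℕ} {s : ℕ → ℕ} (r : CoprimeRecurrence k s) where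
  open CoprimeRecurrence r

  even-k-constant : 2 ∣ k → ∃ λ c → ∀ i → GammaIs (s i) (s (1 + i)) c
  even-k-constant 2∣k = [ (λ g → 1 , everywhere g) , (λ g → 2 , everywhere g) ]′ (coprimeΓ? (positive 0) (positive 1))
    where
    everywhere : GammaAt s 0 v → ∀ i → GammaIs (s i) (s (1 + i)) v
    everywhere g i = coprimeΓ⇒GammaIs (coprime i) (Γ-constant r 2∣k g i)

  odd-k-alternating : ¬ 2 ∣ k → 2 ∣ s 0 → ¬ 2 ∣ s 1 →
                      (∀ i → GammaIs (s i) (s (1 + i)) (xSeq (suc i))) ⊎ (∀ i → GammaIs (s i) (s (1 + i)) (ySeq (suc i)))
  odd-k-alternating ¬2∣k 2∣s₀ ¬2∣s₁ =
    [ inj₁ ∘ following {w = xSeq} xSeq-toggle , inj₂ ∘ following {w = ySeq} ySeq-toggle ]′ (coprimeΓ? (positive 0) (positive 1))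
    where
    following : ∀ {w : ℕ → ℕ} → (∀ i → w (suc i) ≡ toggle (i / 3) v) → GammaAt s 0 v →
                ∀ i → GammaIs (s i) (s (1 + i)) (w (suc i))
    following w≡ g i =
      coprimeΓ⇒GammaIs (coprime i) (subst (GammaAt s i) (sym (w≡ i)) (Γ-odd-pattern r ¬2∣k 2∣s₀ ¬2∣s₁ g i))

reindex : ∀ (A : ℕ → ℕ) o (w : ℕ → ℕ) → (∀ i → GammaIs (A (o + suc i)) (A (o + suc (suc i))) (w (suc i))) →
          ∀ n → 1 ≤ n → GammaIs (A (n + o)) (A (n + suc o)) (w n)
reindex A o w f (suc i) _ = subst₂ (λ l m → GammaIs (A l) (A m) (w (suc i)))
  (+-comm o (suc i)) (trans (+-comm o (suc (suc i))) (cong suc (sym (+-suc i o)))) (f i)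

reindex₀ : ∀ (A : ℕ → ℕ) (w : ℕ → ℕ) → (∀ i → GammaIs (A (suc i)) (A (suc (suc i))) (w (suc i))) →
           ∀ n → 1 ≤ n → GammaIs (A n) (A (n + 1)) (w n)
reindex₀ A w f n n≥1 = subst (λ l → GammaIs (A l) (A (n + 1)) (w n)) (+-identityʳ n) (reindex A 0 w f n n≥1)

theorem5p2 : (a b k : ℕ) → 1 ≤ a → 1 ≤ b → 1 ≤ k → Coprime a b →
    ((2 ∣ k) → ∃ λ c → ∀ n → 1 ≤ n → GammaIs (aSeq a b k n) (aSeq a b k (n + 1)) c)
    × ((¬ 2 ∣ k) → ¬ 2 ∣ a → ¬ 2 ∣ b →
        (∀ n → 1 ≤ n → GammaIs (aSeq a b k (n + 2)) (aSeq a b k (n + 3)) (xSeq n))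
        ⊎ (∀ n → 1 ≤ n → GammaIs (aSeq a b k (n + 2)) (aSeq a b k (n + 3)) (ySeq n)))
    × ((¬ 2 ∣ k) → ¬ 2 ∣ a → 2 ∣ b →
        (∀ n → 1 ≤ n → GammaIs (aSeq a b k (n + 1)) (aSeq a b k (n + 2)) (xSeq n))
        ⊎ (∀ n → 1 ≤ n → GammaIs (aSeq a b k (n + 1)) (aSeq a b k (n + 2)) (ySeq n)))
    × ((¬ 2 ∣ k) → 2 ∣ a → ¬ 2 ∣ b →
        (∀ n → 1 ≤ n → GammaIs (aSeq a b k n) (aSeq a b k (n + 1)) (xSeq n))
        ⊎ (∀ n → 1 ≤ n → GammaIs (aSeq a b k n) (aSeq a b k (n + 1)) (ySeq n)))
theorem5p2 a b k a≥1 b≥1 _ c =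
    (λ 2∣k → let v , f = even-k-constant r 2∣k in v , reindex₀ A (λ _ → v) f)
  , (λ ¬2∣k ¬2∣a ¬2∣b → let 2∣A₃ = odd+odd (odd*odd ¬2∣k ¬2∣b) ¬2∣a in
      Sum.map (reindex A 2 xSeq) (reindex A 2 ySeq)
        (odd-k-alternating (drop (drop r)) ¬2∣k 2∣A₃ (even+odd (∣n⇒∣m*n k 2∣A₃) ¬2∣b)))
  , (λ ¬2∣k ¬2∣a 2∣b →
      Sum.map (reindex A 1 xSeq) (reindex A 1 ySeq)
        (odd-k-alternating (drop r) ¬2∣k 2∣b (even+odd (∣n⇒∣m*n k 2∣b) ¬2∣a)))
  , (λ ¬2∣k 2∣a ¬2∣b →
      Sum.map (reindex₀ A xSeq) (reindex₀ A ySeq) (odd-k-alternating r ¬2∣k 2∣a ¬2∣b))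
  where
  A : ℕ → ℕ
  A = aSeq a b k
  r : CoprimeRecurrence k (A ∘ suc)
  r = coprime-recurrence (λ _ → refl) a≥1 b≥1 c
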